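{- Let $X=w_1^X,x_1,w_2^X,x_2,\ldots,w_m^X,x_m$ and $Y=w_1^Y,y_1,\ldots,w_n^Y,y_n$ be lists (with $w_i^X,w_j^Y\in[0,\infty)$ and labels $x_i$, resp. $y_j$, pairwise distinct within each list) such that $\{x_1,\ldots,x_m\}\cap\{y_1,\ldots,y_n\}=\emptyset$. Then $\mathrm{FreeMerge}(X,Y)$ is a list $Z=w_1^Z,z_1,\ldots,w_{m+n}^Z,z_{m+n}$ satisfying: (1) $\{z_1,\ldots,z_{m+n}\}=\{x_1,\ldots,x_m\}\cup\{y_1,\ldots,y_n\}$; (2) if $z_i=x_a$ and $z_j=x_b$ then $a<b$ implies $i<j$; likewise if $z_i=y_a$ and $z_j=y_b$ then $a<b$ implies $i<j$; (3) $w_1^X=\sum_{i=1}^k w_i^Z$ where $z_k=x_1$, and similarly $w_1^Y=\sum_{i=1}^k w_i^Z$ where $z_k=y_1$; (4) for each $1\le i\le m-1$, if $z_a=x_i$ and $z_b=x_{i+1}$, then $w_{i+1}^X=\sum_{j=a+1}^{b}w_j^Z$; and likewise for each $1\le i\le n-1$, if $z_a=y_i$ and $z_b=y_{i+1}$, then $w_{i+1}^Y=\sum_{j=a+1}^{b}w_j^Z$.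
   Context: Algorithm FreeMerge, defined recursively on two lists of the form $w_1,x_1,\ldots,w_m,x_m$ (alternating nonnegative reals and labels): if $X$ or $Y$ is empty, return the other list. Otherwise let $w_1^Z=\min\{w_1^X,w_1^Y\}$. If $w_1^X<w_1^Y$, set $z_1=x_1$, $X'=w_2^X,x_2,\ldots,w_m^X,x_m$ and $Y'=(w_1^Y-w_1^X),y_1,w_2^Y,y_2,\ldots,w_n^Y,y_n$. Otherwise set $z_1=y_1$, $X'=(w_1^X-w_1^Y),x_1,w_2^X,x_2,\ldots,w_m^X,x_m$ and $Y'=w_2^Y,y_2,\ldots,w_n^Y,y_n$. Return the concatenation $w_1^Z,z_1\,\|\,\mathrm{FreeMerge}(X',Y')$. -}

module Defs where

open import Level using (Level)
open import Algebra.Bundles using (CommutativeRing)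
open import Data.Product using (_×_; _,_; proj₁; proj₂)
open import Data.List using (List; []; _∷_; map; take; drop; foldr)
open import Relation.Binary.Core using (Rel)
open import Relation.Nullary using (Dec; yes; no)
open import Data.Nat using (ℕ)

module FreeMergeDefs {c ℓ r : Level} (R : CommutativeRing c ℓ)
                     (_<_ : Rel (CommutativeRing.Carrier R) r)
                     (_<?_ : (a b : CommutativeRing.Carrier R) → Dec (a < b)) where

  open CommutativeRing R

  WList : ∀ {a} → Set a → Set _
  WList L = List (Carrier × L)

  -- FreeMerge on two nonempty lists, heads given separately
  -- (this makes the recursion structural: lexicographic in (X', Y')).
  freeMerge₁ : ∀ {a} {L : Set a} →
               Carrier → L → WList L → Carrier → L → WList L → WList L
  freeMerge₁ wx x X' wy y Y' with wx <? wy
  freeMerge₁ wx x [] wy y Y' | yes _ = (wx , x) ∷ (wy - wx , y) ∷ Y'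
  freeMerge₁ wx x ((w' , x') ∷ X'') wy y Y' | yes _ =
    (wx , x) ∷ freeMerge₁ w' x' X'' (wy - wx) y Y'
  freeMerge₁ wx x X' wy y [] | no _ = (wy , y) ∷ (wx - wy , x) ∷ X'
  freeMerge₁ wx x X' wy y ((w' , y') ∷ Y'') | no _ =
    (wy , y) ∷ freeMerge₁ (wx - wy) x X' w' y' Y''

  freeMerge : ∀ {a} {L : Set a} → WList L → WList L → WList L
  freeMerge [] Y = Y
  freeMerge (p ∷ X) [] = p ∷ X
  freeMerge ((wx , x) ∷ X) ((wy , y) ∷ Y) = freeMerge₁ wx x X wy y Y

  weights : ∀ {a} {L : Set a} → WList L → List Carrier
  weights = map proj₁

  labels : ∀ {a} {L : Set a} → WList L → List L
  labels = map proj₂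

  sumR : List Carrier → Carrier
  sumR = foldr _+_ 0#

  -- Σ_{j = s+1}^{t} wⱼ   (1-based indices j), i.e. the sum of the entries
  -- at 0-based positions s, …, t-1 of the list.
  sumRange : ℕ → ℕ → List Carrier → Carrier
  sumRange s t ws = sumR (drop s (take t ws))

-- Hence
-- the invariants hold for every interleaving schedule of this kind, and
-- freeMerge is one of them.
module Submission where

open import Defs
open import Level using (Level; _⊔_)
open import Algebra.Bundles using (CommutativeRing)
open import Data.Nat using (suc; _+_; z≤n; s≤s)
open import Data.Nat.Properties using (suc-injective) renaming (+-comm to ℕ-+-comm)
open import Data.Fin using (Fin; toℕ; _<_; zero; suc)
open import Data.Product as Product using (_×_; _,_; proj₁; proj₂)
open import Data.Sum as Sum using (_⊎_; inj₁; inj₂; [_,_])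
open import Data.List using (List; []; _∷_; length; lookup)
open import Data.List.Membership.Propositional using (_∈_; _∉_)
open import Data.List.Relation.Unary.Any using (here; there)
open import Data.List.Relation.Unary.All.Properties using (All¬⇒¬Any)
open import Data.List.Relation.Unary.AllPairs using (_∷_)
open import Data.List.Relation.Unary.Unique.Propositional using (Unique)
open import Data.List.Relation.Binary.Disjoint.Propositional using (Disjoint)
import Data.List.Relation.Binary.Disjoint.Propositional.Properties as Disjoint
open import Data.Empty using (⊥-elim)
open import Relation.Binary.Core using (Rel)
open import Relation.Binary.PropositionalEquality using (_≡_; _≢_; refl; sym; trans; subst; cong)
open import Relation.Nullary using (Dec; yes; no)
import Algebra.Properties.Group as GroupProperties

module FreeMergeProperties {c ℓ r : Level} (R : CommutativeRing c ℓ)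
    (_≺_ : Rel (CommutativeRing.Carrier R) r)
    (_≺?_ : (u v : CommutativeRing.Carrier R) → Dec (u ≺ v))
    {a : Level} {L : Set a} where

  open CommutativeRing R
    using (Carrier; _≈_; _-_; +-cong; +-identityʳ; +-group)
    renaming (_+_ to _⊕_; refl to ≈-refl; sym to ≈-sym; trans to ≈-trans; +-comm to ⊕-comm)
  open GroupProperties +-group using (//-rightDividesˡ)
  open FreeMergeDefs R _≺_ _≺?_

  label : (Z : WList L) → Fin (length Z) → L
  label Z i = proj₂ (lookup Z i)

  weight : (Z : WList L) → Fin (length Z) → Carrier
  weight Z i = proj₁ (lookup Z i)

  label∈labels : (Z : WList L) (i : Fin (length Z)) → label Z i ∈ labels Z
  label∈labels (_ ∷ Z) zero    = here refl
  label∈labels (_ ∷ Z) (suc i) = there (label∈labels Z i)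

  label-reweigh : ∀ {u v : Carrier} {y : L} {Y : WList L} (p : Fin (suc (length Y))) →
                  label ((u , y) ∷ Y) p ≡ label ((v , y) ∷ Y) p
  label-reweigh zero    = refl
  label-reweigh (suc p) = refl

  v≈u+[v-u] : ∀ u v → v ≈ u ⊕ (v - u)
  v≈u+[v-u] u v = ≈-sym (≈-trans (⊕-comm u (v - u)) (//-rightDividesˡ u v))

  OrderPreserving : WList L → WList L → Set a
  OrderPreserving X Z = ∀ (i j : Fin (length Z)) (p q : Fin (length X)) →
    label Z i ≡ label X p → label Z j ≡ label X q → p < q → i < j

  HeadWeight : WList L → WList L → Set (ℓ ⊔ a)
  HeadWeight X Z = ∀ (k : Fin (length Z)) (p : Fin (length X)) → toℕ p ≡ 0 →
    label Z k ≡ label X p → weight X p ≈ sumRange 0 (suc (toℕ k)) (weights Z)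

  StepWeight : WList L → WList L → Set (ℓ ⊔ a)
  StepWeight X Z = ∀ (k l : Fin (length Z)) (p q : Fin (length X)) → toℕ q ≡ suc (toℕ p) →
    label Z k ≡ label X p → label Z l ≡ label X q →
    weight X q ≈ sumRange (suc (toℕ k)) (suc (toℕ l)) (weights Z)

  record Embedding (X Z : WList L) : Set (ℓ ⊔ a) where
    field
      order       : OrderPreserving X Z
      head-weight : HeadWeight X Z
      step-weight : StepWeight X Z
  open Embedding

  Embedding-[] : ∀ Z → Embedding [] Z
  Embedding-[] Z = record
    { order = λ _ _ ()
    ; head-weight = λ _ ()
    ; step-weight = λ _ _ ()
    }

  Embedding-∷ : ∀ {w x X Z} → Embedding X Z → x ∉ labels Z → x ∉ labels X →
                Embedding ((w , x) ∷ X) ((w , x) ∷ Z)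
  Embedding-∷ {w} {x} {X} {Z} e x∉Z x∉X = record
    { order = ord ; head-weight = head ; step-weight = step }
    where
    x≢Z : ∀ i → label Z i ≢ x
    x≢Z i eq = x∉Z (subst (_∈ labels Z) eq (label∈labels Z i))
    x≢X : ∀ p → x ≢ label X p
    x≢X p eq = x∉X (subst (_∈ labels X) (sym eq) (label∈labels X p))

    ord : OrderPreserving ((w , x) ∷ X) ((w , x) ∷ Z)
    ord i       j       zero    zero    _   _   ()
    ord i       j       (suc p) zero    _   _   ()
    ord i       zero    _       (suc q) _   eqj _  = ⊥-elim (x≢X q eqj)
    ord zero    (suc j) zero    (suc q) _   _   _  = s≤s z≤n
    ord (suc i) (suc j) zero    (suc q) eqi _   _  = ⊥-elim (x≢Z i eqi)
    ord zero    (suc j) (suc p) (suc q) eqi _   _  = ⊥-elim (x≢X p eqi)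
    ord (suc i) (suc j) (suc p) (suc q) eqi eqj (s≤s p<q) = s≤s (order e i j p q eqi eqj p<q)

    head : HeadWeight ((w , x) ∷ X) ((w , x) ∷ Z)
    head zero    zero    _  _   = ≈-sym (+-identityʳ w)
    head (suc k) zero    _  eqk = ⊥-elim (x≢Z k eqk)
    head k       (suc p) () _

    step : StepWeight ((w , x) ∷ X) ((w , x) ∷ Z)
    step k       l       zero    zero    ()
    step k       l       (suc p) zero    ()
    step (suc k) l       zero    (suc q) _   eqk _   = ⊥-elim (x≢Z k eqk)
    step zero    zero    zero    (suc q) _   _   eql = ⊥-elim (x≢X q eql)
    step zero    (suc l) zero    (suc q) eq  _   eql = head-weight e l q (suc-injective eq) eql
    step zero    l       (suc p) (suc q) _   eqk _   = ⊥-elim (x≢X p eqk)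
    step (suc k) zero    (suc p) (suc q) _   _   eql = ⊥-elim (x≢X q eql)
    step (suc k) (suc l) (suc p) (suc q) eq  eqk eql =
      step-weight e k l p q (suc-injective eq) eqk eql

  Embedding-shift : ∀ {wx x wy y Y Z} → Embedding ((wy - wx , y) ∷ Y) Z →
                    x ∉ labels ((wy , y) ∷ Y) → Embedding ((wy , y) ∷ Y) ((wx , x) ∷ Z)
  Embedding-shift {wx} {x} {wy} {y} {Y} {Z} e x∉Y′ = record
    { order = ord ; head-weight = head ; step-weight = step }
    where
    Y′ = (wy , y) ∷ Y
    x≢Y′ : ∀ p → x ≢ label Y′ p
    x≢Y′ p eq = x∉Y′ (subst (_∈ labels Y′) (sym eq) (label∈labels Y′ p))
    reweigh : ∀ p → label Y′ p ≡ label ((wy - wx , y) ∷ Y) p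
    reweigh = label-reweigh

    ord : OrderPreserving Y′ ((wx , x) ∷ Z)
    ord zero    j       p q eqi _   _   = ⊥-elim (x≢Y′ p eqi)
    ord (suc i) zero    p q _   eqj _   = ⊥-elim (x≢Y′ q eqj)
    ord (suc i) (suc j) p q eqi eqj p<q =
      s≤s (order e i j p q (trans eqi (reweigh p)) (trans eqj (reweigh q)) p<q)

    head : HeadWeight Y′ ((wx , x) ∷ Z)
    head zero    p       _  eqk = ⊥-elim (x≢Y′ p eqk)
    head (suc k) zero    _  eqk = ≈-trans (v≈u+[v-u] wx wy) (+-cong ≈-refl (head-weight e k zero refl eqk))
    head (suc k) (suc p) () _

    step : StepWeight Y′ ((wx , x) ∷ Z)
    step zero    l       p zero    _  eqk _   = ⊥-elim (x≢Y′ p eqk)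
    step zero    l       p (suc q) _  eqk _   = ⊥-elim (x≢Y′ p eqk)
    step (suc k) zero    p q       _  _   eql = ⊥-elim (x≢Y′ q eql)
    step (suc k) (suc l) p zero    ()
    step (suc k) (suc l) p (suc q) eq eqk eql = step-weight e k l p (suc q) eq (trans eqk (reweigh p)) eql

  Embedding-refl : ∀ X → Unique (labels X) → Embedding X X
  Embedding-refl []      _            = Embedding-[] []
  Embedding-refl (_ ∷ X) (x∉X ∷ uniq) =
    Embedding-∷ (Embedding-refl X uniq) (All¬⇒¬Any x∉X) (All¬⇒¬Any x∉X)

  data Merge : WList L → WList L → WList L → Set (c ⊔ a) where
    []ˡ   : ∀ {Y} → Merge [] Y Y
    emitˡ : ∀ {wx x X wy y Y Z} → Merge X ((wy - wx , y) ∷ Y) Z →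
            Merge ((wx , x) ∷ X) ((wy , y) ∷ Y) ((wx , x) ∷ Z)
    swap  : ∀ {X Y Z} → Merge Y X Z → Merge X Y Z

  freeMerge₁-Merge : ∀ wx x X wy y Y →
                     Merge ((wx , x) ∷ X) ((wy , y) ∷ Y) (freeMerge₁ wx x X wy y Y)
  freeMerge₁-Merge wx x X wy y Y with wx ≺? wy
  freeMerge₁-Merge wx x []                  wy y Y | yes _ = emitˡ []ˡ
  freeMerge₁-Merge wx x ((w′ , x′) ∷ X′)    wy y Y | yes _ =
    emitˡ (freeMerge₁-Merge w′ x′ X′ (wy - wx) y Y)
  freeMerge₁-Merge wx x X wy y []                  | no _ = swap (emitˡ []ˡ)
  freeMerge₁-Merge wx x X wy y ((w′ , y′) ∷ Y′)    | no _ =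
    swap (emitˡ (swap (freeMerge₁-Merge (wx - wy) x X w′ y′ Y′)))

  freeMerge-Merge : ∀ X Y → Merge X Y (freeMerge X Y)
  freeMerge-Merge []            Y             = []ˡ
  freeMerge-Merge (_ ∷ _)       []            = swap []ˡ
  freeMerge-Merge ((wx , x) ∷ X) ((wy , y) ∷ Y) = freeMerge₁-Merge wx x X wy y Y

  Merge-length : ∀ {X Y Z} → Merge X Y Z → length Z ≡ length X + length Y
  Merge-length []ˡ       = refl
  Merge-length (emitˡ m) = cong suc (Merge-length m)
  Merge-length {X} {Y} (swap m) = trans (Merge-length m) (ℕ-+-comm (length Y) (length X))

  ∈-Merge⁺ : ∀ {X Y Z l} → Merge X Y Z → l ∈ labels X ⊎ l ∈ labels Y → l ∈ labels Z
  ∈-Merge⁺ []ˡ       (inj₂ l∈Y)          = l∈Y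
  ∈-Merge⁺ (emitˡ m) (inj₁ (here eq))    = here eq
  ∈-Merge⁺ (emitˡ m) (inj₁ (there l∈X))  = there (∈-Merge⁺ m (inj₁ l∈X))
  ∈-Merge⁺ (emitˡ m) (inj₂ l∈Y)          = there (∈-Merge⁺ m (inj₂ l∈Y))
  ∈-Merge⁺ (swap m)  l∈X⊎Y               = ∈-Merge⁺ m (Sum.swap l∈X⊎Y)

  ∈-Merge⁻ : ∀ {X Y Z l} → Merge X Y Z → l ∈ labels Z → l ∈ labels X ⊎ l ∈ labels Y
  ∈-Merge⁻ []ˡ       l∈Z         = inj₂ l∈Z
  ∈-Merge⁻ (emitˡ m) (here eq)   = inj₁ (here eq)
  ∈-Merge⁻ (emitˡ m) (there l∈Z) = Sum.map₁ there (∈-Merge⁻ m l∈Z)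
  ∈-Merge⁻ (swap m)  l∈Z         = Sum.swap (∈-Merge⁻ m l∈Z)

  Merge-Embedding : ∀ {X Y Z} → Merge X Y Z →
                    Unique (labels X) → Unique (labels Y) → Disjoint (labels X) (labels Y) →
                    Embedding X Z × Embedding Y Z
  Merge-Embedding {Y = Y} []ˡ _ uniqY _ = Embedding-[] Y , Embedding-refl Y uniqY
  Merge-Embedding (emitˡ {x = x} {Z = Z} m) (x∉X ∷ uniqX) uniqY X#Y =
    Embedding-∷ embX x∉Z (All¬⇒¬Any x∉X) , Embedding-shift embY (λ x∈Y → X#Y (here refl , x∈Y))
    where
    embs = Merge-Embedding m uniqX uniqY (λ (l∈X , l∈Y) → X#Y (there l∈X , l∈Y))
    embX = proj₁ embs
    embY = proj₂ embs
    x∉Z : x ∉ labels Z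
    x∉Z x∈Z = [ All¬⇒¬Any x∉X , (λ x∈Y → X#Y (here refl , x∈Y)) ] (∈-Merge⁻ m x∈Z)
  Merge-Embedding (swap m) uniqX uniqY X#Y =
    Product.swap (Merge-Embedding m uniqY uniqX (Disjoint.sym X#Y))

mainTheorem8 : ∀ {c ℓ r a} (R : CommutativeRing c ℓ)
  (_≺_ : Rel (CommutativeRing.Carrier R) r)
  (_≺?_ : (u v : CommutativeRing.Carrier R) → Dec (u ≺ v))
  {L : Set a} (X Y : List (CommutativeRing.Carrier R × L)) →
  let open CommutativeRing R using (_≈_)
      open FreeMergeDefs R _≺_ _≺?_
      Z = freeMerge X Y
      z = λ (i : Fin (length Z)) → proj₂ (lookup Z i)
      x = λ (i : Fin (length X)) → proj₂ (lookup X i)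
      y = λ (i : Fin (length Y)) → proj₂ (lookup Y i)
      wX = λ (i : Fin (length X)) → proj₁ (lookup X i)
      wY = λ (i : Fin (length Y)) → proj₁ (lookup Y i)
  in Unique (labels X) → Unique (labels Y) → Disjoint (labels X) (labels Y) →
  -- Z has m + n entries
  (length Z ≡ length X + length Y)
  -- (1) label sets
  × (∀ l → l ∈ labels Z → l ∈ labels X ⊎ l ∈ labels Y)
  × (∀ l → l ∈ labels X ⊎ l ∈ labels Y → l ∈ labels Z)
  -- (2) order of each list is preserved
  × (∀ (i j : Fin (length Z)) (p q : Fin (length X)) →
       z i ≡ x p → z j ≡ x q → p < q → i < j)
  × (∀ (i j : Fin (length Z)) (p q : Fin (length Y)) →
       z i ≡ y p → z j ≡ y q → p < q → i < j)
  -- (3) first weights: w₁ˣ = Σ_{i=1}^{k} wᵢᶻ where z_k = x₁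
  × (∀ (k : Fin (length Z)) (p : Fin (length X)) → toℕ p ≡ 0 →
       z k ≡ x p → wX p ≈ sumRange 0 (suc (toℕ k)) (weights Z))
  × (∀ (k : Fin (length Z)) (p : Fin (length Y)) → toℕ p ≡ 0 →
       z k ≡ y p → wY p ≈ sumRange 0 (suc (toℕ k)) (weights Z))
  -- (4) later weights: w_{i+1}ˣ = Σ_{j=a+1}^{b} wⱼᶻ where z_a = xᵢ, z_b = x_{i+1}
  × (∀ (k l : Fin (length Z)) (p q : Fin (length X)) → toℕ q ≡ suc (toℕ p) →
       z k ≡ x p → z l ≡ x q →
       wX q ≈ sumRange (suc (toℕ k)) (suc (toℕ l)) (weights Z))
  × (∀ (k l : Fin (length Z)) (p q : Fin (length Y)) → toℕ q ≡ suc (toℕ p) →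
       z k ≡ y p → z l ≡ y q →
       wY q ≈ sumRange (suc (toℕ k)) (suc (toℕ l)) (weights Z))
mainTheorem8 R _≺_ _≺?_ {L = L} X Y uniqX uniqY X#Y =
  Merge-length merge , (λ _ → ∈-Merge⁻ merge) , (λ _ → ∈-Merge⁺ merge)
  , order embX , order embY , head-weight embX , head-weight embY
  , step-weight embX , step-weight embY
  where
  open FreeMergeDefs R _≺_ _≺?_ using (freeMerge)
  open FreeMergeProperties R _≺_ _≺?_ {L = L}
  open Embedding
  merge : Merge X Y (freeMerge X Y)
  merge = freeMerge-Merge X Y
  embX : Embedding X (freeMerge X Y)
  embX = proj₁ (Merge-Embedding merge uniqX uniqY X#Y)
  embY : Embedding Y (freeMerge X Y)
  embY = proj₂ (Merge-Embedding merge uniqX uniqY X#Y)
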